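{- Let $\mathbf{T}=(j_1,\dots,j_n)$ be a nondegenerate ordered set partition of $[n]$ (a cyclic order on $[n]$) all of whose steps $s_i$ are equal to $1$ or $3$. Then one of the following four cases occurs: (1) $s_i=1$ for all $1\le i\le n$; (2) $n$ is not divisible by $3$ and $s_i=3$ for all $1\le i\le n$; (3) $n=4k+2$ and $s_{2i-1}=1$, $s_{2i}=3$ for all $1\le i\le 2k+1$; (4) $n=4k+2$ and $s_{2i-1}=3$, $s_{2i}=1$ for all $1\le i\le 2k+1$.
   Context: For a cyclic order $\mathbf{T}=(j_1,\dots,j_n)$ on $[n]$ (a nondegenerate ordered set partition, all blocks singletons), its $i$-th step is $s_i=j_{i+1}-j_i \bmod n$ for $1\le i<n$, and $s_n=j_1-j_n\bmod n$. -}

module Defs where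

open import Data.Nat using (ℕ; zero; suc; _+_; _*_; _∸_; _%_)
open import Data.Nat.Divisibility using (_∣_)
open import Data.Fin using (Fin; toℕ)
open import Data.Product using (Σ; ∃; _×_)
open import Data.Sum using (_⊎_)
open import Relation.Nullary using (¬_)
open import Relation.Binary.PropositionalEquality using (_≡_)
open import Function.Bundles using (_↔_; Inverse)

-- A cyclic order (nondegenerate ordered set partition with singleton blocks)
-- on [n], n = suc m, encoded 0-based: positions Fin n, values Fin n
-- (value v stands for element v+1 of [n]; steps are invariant under this shift).
-- T is a bijection: position p ↦ j_{p+1}.
CyclicOrder : ℕ → Set
CyclicOrder n = Fin n ↔ Fin n

nextPos : (m : ℕ) → Fin (suc m) → Fin (suc m)
nextPos m p = Data.Fin.fromℕ< {(suc (toℕ p)) % suc m} (Data.Nat.DivMod.m%n<n (suc (toℕ p)) (suc m))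
  where import Data.Nat.DivMod

-- step T p  =  s_{p+1} = (j_{p+2} - j_{p+1}) mod n  (indices of j cyclic),
-- computed as (j_{p+2} + n - j_{p+1}) mod n in ℕ.
step : (m : ℕ) → CyclicOrder (suc m) → Fin (suc m) → ℕ
step m T p =
  (toℕ (Inverse.to T (nextPos m p)) + suc m ∸ toℕ (Inverse.to T p)) % suc m

-- if-even-then i a b = a if i is even, b otherwise.
-- Position p (0-based) is s_{p+1}; p even ⇔ p+1 odd, i.e. s_{2i-1}.
if-even-then : ℕ → ℕ → ℕ → ℕ
if-even-then zero a b = a
if-even-then (suc zero) a b = b
if-even-then (suc (suc i)) a b = if-even-then i a b

-- Read the cyclic order as the permutation π of ℤ/n sending each value to the one following it,
-- so π u = u + d u with every jump d u ∈ {1, 3}.  The jump function d is 2-periodic: if u jumps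
-- by 1, the predecessor of u + 3 cannot be u, so it is u + 2, which then jumps by 1; if u jumps
-- by 3, then u + 2 cannot also jump by 1 onto u + 3.  As d (π u) + d u is even, d ∘ π² = d, so
-- the steps alternate s₁, s₂, s₁, s₂, …, and for odd n this forces s₁ = s₂.  Finally the values
-- visited lie in the classes of j₁ and j₁ + s₁ modulo 3 (all steps 3) resp. modulo 4 (steps 1
-- and 3 alternating), which is impossible when 3 ∣ n resp. 4 ∣ n since every value is visited.
module Submission where

open import Defs
open import Data.Nat using (ℕ; zero; suc; pred; _+_; _*_; _∸_; _%_; _≤_; _<_; NonZero; >-nonZero⁻¹; s≤s; z≤n)
open import Data.Nat.Properties using (+-comm; +-assoc; +-suc; *-assoc; *-suc; suc-pred; m∸n+n≡m; m≤n+m; <⇒≤; ≤-trans)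
open import Data.Nat.DivMod using (_mod_; m%n<n; m%n%n≡m%n; %-distribˡ-+; [m+n]%n≡m%n; n%n≡0; [m+kn]%n≡m%n; m<n⇒m%n≡m; m∣n⇒o%n%m≡o%m)
open import Data.Nat.Divisibility using (_∣_; divides)
open import Data.Nat.Tactic.RingSolver using (solve-∀)
open import Data.Fin using (Fin; toℕ)
open import Data.Fin.Properties using (toℕ-injective; toℕ-fromℕ<; toℕ<n)
open import Data.Product using (∃; _×_; _,_)
open import Data.Sum using (_⊎_; inj₁; inj₂; [_,_])
open import Data.Empty using (⊥-elim)
open import Relation.Nullary using (¬_; contradiction)
open import Relation.Binary.PropositionalEquality using (_≡_; _≢_; refl; sym; trans; cong; cong₂; subst; module ≡-Reasoning)
open import Function.Base using (case_of_)
open import Function.Bundles using (Inverse)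

infix 4 _≡_modulo_
_≡_modulo_ : ℕ → ℕ → (M : ℕ) → .{{NonZero M}} → Set
_≡_modulo_ x y M = x % M ≡ y % M

module _ {M : ℕ} .{{_ : NonZero M}} where
  open ≡-Reasoning

  %-congruent : ∀ x → x % M ≡ x modulo M
  %-congruent x = m%n%n≡m%n x M

  +-cong-mod : ∀ {x x′ y y′} → x ≡ x′ modulo M → y ≡ y′ modulo M → x + y ≡ x′ + y′ modulo M
  +-cong-mod {x} {x′} {y} {y′} x≡x′ y≡y′ = begin
    (x + y) % M             ≡⟨ %-distribˡ-+ x y M ⟩
    (x % M + y % M) % M     ≡⟨ cong₂ (λ a b → (a + b) % M) x≡x′ y≡y′ ⟩
    (x′ % M + y′ % M) % M   ≡⟨ %-distribˡ-+ x′ y′ M ⟨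
    (x′ + y′) % M           ∎

  +-cancelʳ-mod : ∀ {x y} c → x + c ≡ y + c modulo M → x ≡ y modulo M
  +-cancelʳ-mod {x} {y} c x+c≡y+c = begin
    x % M                       ≡⟨ [m+kn]%n≡m%n x c M ⟨
    (x + c * M) % M             ≡⟨ cong (_% M) (regroup x) ⟩
    (x + c + c * pred M) % M    ≡⟨ +-cong-mod {x + c} {y + c} x+c≡y+c refl ⟩
    (y + c + c * pred M) % M    ≡⟨ cong (_% M) (regroup y) ⟨
    (y + c * M) % M             ≡⟨ [m+kn]%n≡m%n y c M ⟩
    y % M                       ∎
    where
    regroup : ∀ z → z + c * M ≡ z + c + c * pred M
    regroup z = trans (cong (λ k → z + c * k) (sym (suc-pred M)))
                      (trans (cong (z +_) (*-suc c (pred M))) (sym (+-assoc z c (c * pred M))))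

  +-cancelˡ-mod : ∀ {x y} c → c + x ≡ c + y modulo M → x ≡ y modulo M
  +-cancelˡ-mod {x} {y} c c+x≡c+y =
    +-cancelʳ-mod c (trans (cong (_% M) (+-comm x c)) (trans c+x≡c+y (cong (_% M) (+-comm c y))))

  congruent-divisor : ∀ {d x y} .{{_ : NonZero d}} → d ∣ M → x ≡ y modulo M → x ≡ y modulo d
  congruent-divisor {d} {x} {y} d∣M x≡y =
    trans (sym (m∣n⇒o%n%m≡o%m d M x d∣M)) (trans (cong (_% d) x≡y) (m∣n⇒o%n%m≡o%m d M y d∣M))

  congruent-<⇒≡ : ∀ {x y} → x < M → y < M → x ≡ y modulo M → x ≡ y
  congruent-<⇒≡ x<M y<M x≡y = trans (sym (m<n⇒m%n≡m x<M)) (trans x≡y (m<n⇒m%n≡m y<M))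

  toℕ-mod : ∀ x → toℕ (x mod M) ≡ x modulo M
  toℕ-mod x = trans (cong (_% M) (toℕ-fromℕ< (m%n<n x M))) (%-congruent x)

  toℕ-congruent-injective : ∀ {u v : Fin M} → toℕ u ≡ toℕ v modulo M → u ≡ v
  toℕ-congruent-injective {u} {v} u≡v = toℕ-injective (congruent-<⇒≡ (toℕ<n u) (toℕ<n v) u≡v)

  mod-cong : ∀ {x y} → x ≡ y modulo M → x mod M ≡ y mod M
  mod-cong x≡y = toℕ-congruent-injective (trans (toℕ-mod _) (trans x≡y (sym (toℕ-mod _))))

  toℕ-mod-inverse : ∀ (u : Fin M) → toℕ u mod M ≡ u
  toℕ-mod-inverse u = toℕ-congruent-injective (toℕ-mod (toℕ u))

OneOrThree : ℕ → Set
OneOrThree x = x ≡ 1 ⊎ x ≡ 3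

oneOrThree-sum-even : ∀ {a b} → OneOrThree a → OneOrThree b → ∃ λ j → a + b ≡ j * 2
oneOrThree-sum-even (inj₁ refl) (inj₁ refl) = 1 , refl
oneOrThree-sum-even (inj₁ refl) (inj₂ refl) = 2 , refl
oneOrThree-sum-even (inj₂ refl) (inj₁ refl) = 2 , refl
oneOrThree-sum-even (inj₂ refl) (inj₂ refl) = 3 , refl

data EvenOrOdd (x : ℕ) : Set where
  even : ∀ j → x ≡ j * 2 → EvenOrOdd x
  odd  : ∀ j → x ≡ 1 + j * 2 → EvenOrOdd x

evenOrOdd : ∀ x → EvenOrOdd x
evenOrOdd zero = even 0 refl
evenOrOdd (suc zero) = odd 0 refl
evenOrOdd (suc (suc x)) with evenOrOdd x
... | even j x≡2j   = even (suc j) (cong (2 +_) x≡2j)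
... | odd j x≡1+2j  = odd (suc j) (cong (2 +_) x≡1+2j)

if-even-then-same : ∀ k c → if-even-then k c c ≡ c
if-even-then-same zero c = refl
if-even-then-same (suc zero) c = refl
if-even-then-same (suc (suc k)) c = if-even-then-same k c

if-even-then-cases : ∀ k a b → if-even-then k a b ≡ a ⊎ if-even-then k a b ≡ b
if-even-then-cases zero a b = inj₁ refl
if-even-then-cases (suc zero) a b = inj₂ refl
if-even-then-cases (suc (suc k)) a b = if-even-then-cases k a b

if-even-then-odd : ∀ j a b → if-even-then (1 + j * 2) a b ≡ b
if-even-then-odd zero a b = refl
if-even-then-odd (suc j) a b = if-even-then-odd j a b

2-periodic⇒if-even-then : (g : ℕ → ℕ) → (∀ k → g (2 + k) ≡ g k) →
                          ∀ k → g k ≡ if-even-then k (g 0) (g 1)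
2-periodic⇒if-even-then g periodic zero = refl
2-periodic⇒if-even-then g periodic (suc zero) = refl
2-periodic⇒if-even-then g periodic (suc (suc k)) =
  trans (periodic k) (2-periodic⇒if-even-then g periodic k)

alternating-partial-sum : ∀ {M} .{{_ : NonZero M}} {e o} → e + o ≡ 0 modulo M →
  ∀ k → if-even-then k e o + if-even-then k 0 e ≡ if-even-then (suc k) 0 e modulo M
alternating-partial-sum {M} {e = e} e+o≡0 zero = cong (_% M) (+-comm e 0)
alternating-partial-sum {M} {e = e} {o} e+o≡0 (suc zero) = trans (cong (_% M) (+-comm o e)) e+o≡0
alternating-partial-sum e+o≡0 (suc (suc k)) = alternating-partial-sum e+o≡0 k

module _ (m : ℕ) where
  private
    n : ℕ
    n = suc m

  nextPos-mod : ∀ k → nextPos m (k mod n) ≡ suc k mod n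
  nextPos-mod k = mod-cong {M = n} {suc (toℕ (k mod n))} {suc k}
                    (+-cong-mod {x = 1} {1} {toℕ (k mod n)} {k} refl (toℕ-mod k))

  nextPos-injective : ∀ {p q} → nextPos m p ≡ nextPos m q → p ≡ q
  nextPos-injective {p} {q} next≡ = toℕ-congruent-injective (+-cancelˡ-mod {M = n} 1 (begin
    suc (toℕ p) % n              ≡⟨ toℕ-mod {M = n} (suc (toℕ p)) ⟨
    toℕ (nextPos m p) % n        ≡⟨ cong (λ r → toℕ r % n) next≡ ⟩
    toℕ (nextPos m q) % n        ≡⟨ toℕ-mod {M = n} (suc (toℕ q)) ⟩
    suc (toℕ q) % n              ∎))
    where open ≡-Reasoning

  prevPos : Fin n → Fin n
  prevPos q = (toℕ q + m) mod n

  nextPos-prevPos : ∀ q → nextPos m (prevPos q) ≡ q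
  nextPos-prevPos q = begin
    nextPos m ((toℕ q + m) mod n)   ≡⟨ nextPos-mod (toℕ q + m) ⟩
    suc (toℕ q + m) mod n           ≡⟨ cong (_mod n) (+-suc (toℕ q) m) ⟨
    (toℕ q + n) mod n               ≡⟨ mod-cong {M = n} {toℕ q + n} {toℕ q} ([m+n]%n≡m%n (toℕ q) n) ⟩
    toℕ q mod n                     ≡⟨ toℕ-mod-inverse q ⟩
    q                               ∎
    where open ≡-Reasoning

module JumpsByOneOrThree {n : ℕ} .{{_ : NonZero n}}
  (π : Fin n → Fin n) (π-injective : ∀ {u v} → π u ≡ π v → u ≡ v)
  (π⁻¹ : Fin n → Fin n) (π-π⁻¹ : ∀ w → π (π⁻¹ w) ≡ w)
  (d : Fin n → ℕ) (π-jumps : ∀ u → toℕ (π u) ≡ d u + toℕ u modulo n)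
  (d<n : ∀ u → d u < n) (d-oneOrThree : ∀ u → OneOrThree (d u)) where

  private
    D : ℕ → ℕ
    D x = d (x mod n)

    D-cong : ∀ {x y} → x ≡ y modulo n → D x ≡ D y
    D-cong x≡y = cong d (mod-cong x≡y)

    d≡D∘toℕ : ∀ u → d u ≡ D (toℕ u)
    d≡D∘toℕ u = cong d (sym (toℕ-mod-inverse u))

    π-mod : ∀ {x c} → D x ≡ c → π (x mod n) ≡ (c + x) mod n
    π-mod {x} refl = toℕ-congruent-injective (begin
      toℕ (π (x mod n)) % n          ≡⟨ π-jumps (x mod n) ⟩
      (D x + toℕ (x mod n)) % n      ≡⟨ +-cong-mod {x = D x} refl (toℕ-mod x) ⟩
      (D x + x) % n                  ≡⟨ toℕ-mod (D x + x) ⟨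
      toℕ ((D x + x) mod n) % n      ∎)
      where open ≡-Reasoning

    source-of-jump : ∀ {u c x} → d u ≡ c → π u ≡ (c + x) mod n → u ≡ x mod n
    source-of-jump {u} {c} {x} refl πu≡c+x = begin
      u                 ≡⟨ toℕ-mod-inverse u ⟨
      toℕ u mod n       ≡⟨ mod-cong (+-cancelˡ-mod (d u) (begin
                             (d u + toℕ u) % n           ≡⟨ π-jumps u ⟨
                             toℕ (π u) % n               ≡⟨ cong (λ r → toℕ r % n) πu≡c+x ⟩
                             toℕ ((d u + x) mod n) % n   ≡⟨ toℕ-mod (d u + x) ⟩
                             (d u + x) % n               ∎)) ⟩
      x mod n           ∎
      where open ≡-Reasoning

    D-2-periodic : ∀ x → D (2 + x) ≡ D x
    D-2-periodic x with d-oneOrThree (x mod n)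
    ... | inj₁ Dx≡1 = from-predecessor (π⁻¹ ((3 + x) mod n)) (d-oneOrThree _) (π-π⁻¹ _)
      where
      from-predecessor : ∀ u → OneOrThree (d u) → π u ≡ (3 + x) mod n → D (2 + x) ≡ D x
      from-predecessor u (inj₁ du≡1) πu≡3+x =
        trans (cong d (sym (source-of-jump du≡1 πu≡3+x))) (trans du≡1 (sym Dx≡1))
      from-predecessor u (inj₂ du≡3) πu≡3+x =
        contradiction (trans (sym du≡3) (trans (cong d (source-of-jump du≡3 πu≡3+x)) Dx≡1)) λ ()
    ... | inj₂ Dx≡3 with d-oneOrThree ((2 + x) mod n)
    ...   | inj₂ D2+x≡3 = trans D2+x≡3 (sym Dx≡3)
    ...   | inj₁ D2+x≡1 =
      contradiction (congruent-<⇒≡ 2<n (>-nonZero⁻¹ n) (+-cancelʳ-mod {x = 2} {y = 0} x (sym x≡2+x))) λ ()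
      where
      2<n : 2 < n
      2<n = ≤-trans (s≤s (s≤s (s≤s z≤n))) (subst (_< n) Dx≡3 (d<n (x mod n)))
      x≡2+x : x ≡ 2 + x modulo n
      x≡2+x = trans (sym (toℕ-mod x))
        (trans (cong (λ r → toℕ r % n) (π-injective (trans (π-mod Dx≡3) (sym (π-mod D2+x≡1)))))
               (toℕ-mod (2 + x)))

    D-even-periodic : ∀ j x → D (j * 2 + x) ≡ D x
    D-even-periodic zero x = refl
    D-even-periodic (suc j) x = trans (D-2-periodic (j * 2 + x)) (D-even-periodic j x)

  jump-π² : ∀ u → d (π (π u)) ≡ d u
  jump-π² u with j , sum≡2j ← oneOrThree-sum-even (d-oneOrThree (π u)) (d-oneOrThree u) = begin
    d (π (π u))                    ≡⟨ d≡D∘toℕ (π (π u)) ⟩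
    D (toℕ (π (π u)))              ≡⟨ D-cong (trans (π-jumps (π u)) (+-cong-mod {x = d (π u)} refl (π-jumps u))) ⟩
    D (d (π u) + (d u + toℕ u))    ≡⟨ cong D (sym (+-assoc (d (π u)) (d u) (toℕ u))) ⟩
    D (d (π u) + d u + toℕ u)      ≡⟨ cong (λ s → D (s + toℕ u)) sum≡2j ⟩
    D (j * 2 + toℕ u)              ≡⟨ D-even-periodic j (toℕ u) ⟩
    D (toℕ u)                      ≡⟨ d≡D∘toℕ u ⟨
    d u                            ∎
    where open ≡-Reasoning

module CyclicOrderSteps (m : ℕ) (T : CyclicOrder (suc m))
  (one-or-three : ∀ p → OneOrThree (step m T p)) where

  open Inverse T using (to; from; strictlyInverseˡ; strictlyInverseʳ)
  open ≡-Reasoning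

  private
    n : ℕ
    n = suc m

  value-nextPos : ∀ p → toℕ (to (nextPos m p)) ≡ step m T p + toℕ (to p) modulo n
  value-nextPos p = begin
    y % n                ≡⟨ [m+n]%n≡m%n y n ⟨
    (y + n) % n          ≡⟨ cong (_% n) (m∸n+n≡m x≤y+n) ⟨
    (y + n ∸ x + x) % n  ≡⟨ +-cong-mod {x = step m T p} {y + n ∸ x} {x} {x} (%-congruent (y + n ∸ x)) refl ⟨
    (step m T p + x) % n ∎
    where
    x = toℕ (to p)
    y = toℕ (to (nextPos m p))
    x≤y+n : x ≤ y + n
    x≤y+n = ≤-trans (<⇒≤ (toℕ<n (to p))) (m≤n+m n y)

  step<n : ∀ p → step m T p < n
  step<n p = m%n<n (toℕ (to (nextPos m p)) + n ∸ toℕ (to p)) n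

  successor : Fin n → Fin n
  successor u = to (nextPos m (from u))

  jump : Fin n → ℕ
  jump u = step m T (from u)

  successor-jumps : ∀ u → toℕ (successor u) ≡ jump u + toℕ u modulo n
  successor-jumps u = subst (λ v → toℕ (successor u) ≡ jump u + toℕ v modulo n)
                            (strictlyInverseˡ u) (value-nextPos (from u))

  successor-injective : ∀ {u v} → successor u ≡ successor v → u ≡ v
  successor-injective {u} {v} eq = begin
    u                ≡⟨ strictlyInverseˡ u ⟨
    to (from u)      ≡⟨ cong to (nextPos-injective m (begin
                          nextPos m (from u)               ≡⟨ strictlyInverseʳ _ ⟨
                          from (successor u)               ≡⟨ cong from eq ⟩
                          from (successor v)               ≡⟨ strictlyInverseʳ _ ⟩
                          nextPos m (from v)               ∎)) ⟩
    to (from v)      ≡⟨ strictlyInverseˡ v ⟩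
    v                ∎

  predecessor : Fin n → Fin n
  predecessor w = to (prevPos m (from w))

  successor-predecessor : ∀ w → successor (predecessor w) ≡ w
  successor-predecessor w = begin
    to (nextPos m (from (to (prevPos m (from w)))))  ≡⟨ cong (λ q → to (nextPos m q)) (strictlyInverseʳ _) ⟩
    to (nextPos m (prevPos m (from w)))              ≡⟨ cong to (nextPos-prevPos m (from w)) ⟩
    to (from w)                                      ≡⟨ strictlyInverseˡ w ⟩
    w                                                ∎

  open JumpsByOneOrThree successor successor-injective predecessor successor-predecessor
    jump successor-jumps (λ u → step<n (from u)) (λ u → one-or-three (from u))

  step-nextPos² : ∀ p → step m T (nextPos m (nextPos m p)) ≡ step m T p
  step-nextPos² p = begin
    step m T (nextPos m (nextPos m p))      ≡⟨ cong (step m T) (strictlyInverseʳ _) ⟨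
    jump (to (nextPos m (nextPos m p)))     ≡⟨ cong (λ q → jump (to (nextPos m q))) (strictlyInverseʳ _) ⟨
    jump (successor (to (nextPos m p)))     ≡⟨ cong (λ q → jump (successor (to (nextPos m q)))) (strictlyInverseʳ p) ⟨
    jump (successor (successor (to p)))     ≡⟨ jump-π² (to p) ⟩
    jump (to p)                             ≡⟨ cong (step m T) (strictlyInverseʳ p) ⟩
    step m T p                              ∎

  firstStep secondStep : ℕ
  firstStep = step m T (0 mod n)
  secondStep = step m T (1 mod n)

  steps-alternate-mod : ∀ {e o} → firstStep ≡ e → secondStep ≡ o →
                        ∀ k → step m T (k mod n) ≡ if-even-then k e o
  steps-alternate-mod first≡e second≡o k = begin
    step m T (k mod n)                           ≡⟨ 2-periodic⇒if-even-then (λ j → step m T (j mod n)) periodic k ⟩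
    if-even-then k firstStep secondStep          ≡⟨ cong₂ (if-even-then k) first≡e second≡o ⟩
    if-even-then k _ _                           ∎
    where
    periodic : ∀ j → step m T ((2 + j) mod n) ≡ step m T (j mod n)
    periodic j = begin
      step m T ((2 + j) mod n)                    ≡⟨ cong (step m T) (nextPos-mod m (suc j)) ⟨
      step m T (nextPos m (suc j mod n))          ≡⟨ cong (λ q → step m T (nextPos m q)) (nextPos-mod m j) ⟨
      step m T (nextPos m (nextPos m (j mod n)))  ≡⟨ step-nextPos² (j mod n) ⟩
      step m T (j mod n)                          ∎

  steps-alternate : ∀ {e o} → firstStep ≡ e → secondStep ≡ o →
                    ∀ p → step m T p ≡ if-even-then (toℕ p) e o
  steps-alternate first≡e second≡o p =
    trans (cong (step m T) (sym (toℕ-mod-inverse p))) (steps-alternate-mod first≡e second≡o (toℕ p))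

  steps-constant : ∀ {c} → firstStep ≡ c → secondStep ≡ c → ∀ p → step m T p ≡ c
  steps-constant {c} first≡c second≡c p =
    trans (steps-alternate first≡c second≡c p) (if-even-then-same (toℕ p) c)

  odd-length⇒firstStep≡secondStep : ∀ j → n ≡ 1 + j * 2 → firstStep ≡ secondStep
  odd-length⇒firstStep≡secondStep j n≡1+2j = begin
    step m T (0 mod n)                         ≡⟨ cong (step m T) (mod-cong {M = n} {0} {n} (sym (n%n≡0 n))) ⟩
    step m T (n mod n)                         ≡⟨ steps-alternate-mod refl refl n ⟩
    if-even-then n firstStep secondStep        ≡⟨ cong (λ k → if-even-then k firstStep secondStep) n≡1+2j ⟩
    if-even-then (1 + j * 2) firstStep secondStep ≡⟨ if-even-then-odd j firstStep secondStep ⟩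
    secondStep                                 ∎

  module _ {M : ℕ} .{{_ : NonZero M}} (M∣n : M ∣ n) {e o : ℕ}
    (first≡e : firstStep ≡ e) (second≡o : secondStep ≡ o) (e+o≡0 : e + o ≡ 0 modulo M) where

    private
      value₀ : ℕ
      value₀ = toℕ (to (0 mod n))

    values-alternate : ∀ k → toℕ (to (k mod n)) ≡ if-even-then k 0 e + value₀ modulo M
    values-alternate zero = refl
    values-alternate (suc k) = begin
      toℕ (to (suc k mod n)) % M
        ≡⟨ cong (λ q → toℕ (to q) % M) (nextPos-mod m k) ⟨
      toℕ (to (nextPos m (k mod n))) % M
        ≡⟨ congruent-divisor M∣n (value-nextPos (k mod n)) ⟩
      (step m T (k mod n) + vₖ) % M
        ≡⟨ cong (λ s → (s + vₖ) % M) (steps-alternate-mod first≡e second≡o k) ⟩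
      (if-even-then k e o + vₖ) % M
        ≡⟨ +-cong-mod {x = if-even-then k e o} refl (values-alternate k) ⟩
      (if-even-then k e o + (if-even-then k 0 e + value₀)) % M
        ≡⟨ cong (_% M) (+-assoc (if-even-then k e o) _ value₀) ⟨
      (if-even-then k e o + if-even-then k 0 e + value₀) % M
        ≡⟨ +-cong-mod {y = value₀} (alternating-partial-sum e+o≡0 k) refl ⟩
      (if-even-then (suc k) 0 e + value₀) % M
        ∎
      where
      vₖ : ℕ
      vₖ = toℕ (to (k mod n))

    residues-alternate : ∀ c → c ≡ 0 modulo M ⊎ c ≡ e modulo M
    residues-alternate c =
      Data.Sum.map (λ eq → trans c≡residue (cong (_% M) eq)) (λ eq → trans c≡residue (cong (_% M) eq))
                   (if-even-then-cases k 0 e)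
      where
      w : Fin n
      w = (c + value₀) mod n
      k : ℕ
      k = toℕ (from w)
      c≡residue : c ≡ if-even-then k 0 e modulo M
      c≡residue = +-cancelʳ-mod value₀ (begin
        (c + value₀) % M                ≡⟨ congruent-divisor M∣n (toℕ-mod (c + value₀)) ⟨
        toℕ w % M                       ≡⟨ cong (λ q → toℕ q % M) (strictlyInverseˡ w) ⟨
        toℕ (to (from w)) % M           ≡⟨ cong (λ q → toℕ (to q) % M) (toℕ-mod-inverse (from w)) ⟨
        toℕ (to (k mod n)) % M          ≡⟨ values-alternate k ⟩
        (if-even-then k 0 e + value₀) % M ∎)

  constant-three⇒3∤length : firstStep ≡ 3 → secondStep ≡ 3 → ¬ (3 ∣ n)
  constant-three⇒3∤length first≡3 second≡3 3∣n =
    [ (λ ()) , (λ ()) ] (residues-alternate 3∣n first≡3 second≡3 refl 1)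

  alternating-length : ∀ {e o} → firstStep ≡ e → secondStep ≡ o → e ≢ o →
    e + o ≡ 0 modulo 4 → ¬ (2 ≡ e modulo 4) → ∃ λ k → n ≡ 4 * k + 2
  alternating-length {e} {o} first≡e second≡o e≢o e+o≡0 2≢e with evenOrOdd n
  ... | odd j n≡1+2j =
    contradiction (trans (sym first≡e) (trans (odd-length⇒firstStep≡secondStep j n≡1+2j) second≡o)) e≢o
  ... | even j n≡2j with evenOrOdd j
  ...   | even i j≡2i =
    ⊥-elim ([ (λ ()) , 2≢e ] (residues-alternate (divides i n≡4i) first≡e second≡o e+o≡0 2))
    where
    n≡4i : n ≡ i * 4
    n≡4i = trans n≡2j (trans (cong (_* 2) j≡2i) (*-assoc i 2 2))
  ...   | odd i j≡1+2i = i , trans n≡2j (trans (cong (_* 2) j≡1+2i) (regroup i))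
    where
    regroup : ∀ i → (1 + i * 2) * 2 ≡ 4 * i + 2
    regroup = solve-∀

proposition5p9 : (m : ℕ) → (T : CyclicOrder (suc m)) →
    ((p : Fin (suc m)) → (step m T p ≡ 1) ⊎ (step m T p ≡ 3)) →
    ((p : Fin (suc m)) → step m T p ≡ 1)
    ⊎ ((¬ (3 ∣ suc m)) × ((p : Fin (suc m)) → step m T p ≡ 3))
    ⊎ (∃ λ k → (suc m ≡ 4 * k + 2) ×
        ((p : Fin (suc m)) → step m T p ≡ (if-even-then (toℕ p) 1 3)))
    ⊎ (∃ λ k → (suc m ≡ 4 * k + 2) ×
        ((p : Fin (suc m)) → step m T p ≡ (if-even-then (toℕ p) 3 1)))
proposition5p9 m T one-or-three =
  case one-or-three (0 mod suc m) , one-or-three (1 mod suc m) of λ where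
    (inj₁ first≡1 , inj₁ second≡1) → inj₁ (steps-constant first≡1 second≡1)
    (inj₂ first≡3 , inj₂ second≡3) →
      inj₂ (inj₁ (constant-three⇒3∤length first≡3 second≡3 , steps-constant first≡3 second≡3))
    (inj₁ first≡1 , inj₂ second≡3) →
      let k , n≡4k+2 = alternating-length first≡1 second≡3 (λ ()) refl (λ ())
      in inj₂ (inj₂ (inj₁ (k , n≡4k+2 , steps-alternate first≡1 second≡3)))
    (inj₂ first≡3 , inj₁ second≡1) →
      let k , n≡4k+2 = alternating-length first≡3 second≡1 (λ ()) refl (λ ())
      in inj₂ (inj₂ (inj₂ (k , n≡4k+2 , steps-alternate first≡3 second≡1)))
  where open CyclicOrderSteps m T one-or-three
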